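{- Every $2$-arc-strong oriented graph on at least seven vertices contains a directed path on $6$ vertices.
   Context: An oriented graph is a digraph without loops, multiple arcs or digons. A digraph $D$ is $2$-arc-strong if for every nonempty proper subset $X\subset V(D)$ at least two arcs have tail in $X$ and head outside $X$. -}

module Defs where

open import Data.Nat using (ℕ; zero; suc; _+_; _≤_)
open import Data.Bool using (Bool; true; false; _∧_; not; if_then_else_)
open import Data.Fin using (Fin; inject₁; fromℕ; toℕ)
open import Data.Fin.Subset using (Subset; _∈_; _∉_; Nonempty; ⊤)
open import Data.Vec using (lookup)
open import Data.Vec.Functional using () renaming (foldr to vfoldr)
open import Data.Product using (Σ; _×_; ∃)
open import Relation.Binary.PropositionalEquality using (_≡_; _≢_)
open import Relation.Nullary using (¬_)
open import Function.Definitions using (Injective)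
open import Data.Unit using () renaming (⊤ to Unit)

-- This representation excludes multiple arcs automatically.
record Digraph (n : ℕ) : Set where
  field
    arc : Fin n → Fin n → Bool
open Digraph public

IsOriented : ∀ {n} → Digraph n → Set
IsOriented {n} D =
  (∀ (v : Fin n) → arc D v v ≡ false) ×
  (∀ (u v : Fin n) → arc D u v ≡ true → arc D v u ≡ false)

sumFin : ∀ {n} → (Fin n → ℕ) → ℕ
sumFin {zero} f = 0
sumFin {suc n} f = f Fin.zero + sumFin {n} (λ i → f (Fin.suc i))

memb : ∀ {n} → Subset n → Fin n → Bool
memb X v = lookup X v

outArcs : ∀ {n} → Digraph n → Subset n → ℕ
outArcs D X =
  sumFin (λ u → sumFin (λ v →
    if memb X u ∧ not (memb X v) ∧ arc D u v then 1 else 0))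

NonemptyProper : ∀ {n} → Subset n → Set
NonemptyProper {n} X = Nonempty X × (∃ λ (v : Fin n) → v ∉ X)

IsTwoArcStrong : ∀ {n} → Digraph n → Set
IsTwoArcStrong D = ∀ X → NonemptyProper X → 2 ≤ outArcs D X

HasDirectedPath : ∀ {n} → Digraph n → ℕ → Set
HasDirectedPath {n} D zero = Unit
HasDirectedPath {n} D (suc k) =
  Σ (Fin (suc k) → Fin n) λ p →
    Injective _≡_ _≡_ p ×
    (∀ (i : Fin k) → arc D (p (inject₁ i)) (p (Fin.suc i)) ≡ true)

module Submission where

-- Cutting off a single vertex, or everything but one vertex, shows that every vertex has two
-- out- and two in-neighbours; any other nonempty proper vertex set is entered by an arc. A path
-- grows by a fresh in-neighbour of its first vertex or out-neighbour of its last one, and in an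
-- oriented graph only few vertices of a short path can compete with such a fresh neighbour.
-- When all competitors are in fact neighbours, the vertex set of the path can be traversed
-- starting from any of its vertices: the path closes into a cycle, or (on five vertices
-- q₀ … q₄) it carries the chords q₄q₁, q₄q₂, q₂q₀, q₃q₀, q₁q₃. An arc entering that vertex
-- set from outside then yields a longer path.

open import Defs
open import Level using (0ℓ)
open import Data.Nat using (ℕ; zero; suc; _≤_; _<_; z≤n; s≤s; z<s; s<s)
open import Data.Nat.Properties using (<⇒≱; <-trans; n<1+n)
open import Data.Bool using (Bool; true; false; _∧_; not; if_then_else_)
open import Data.Bool.Properties using (not-injective) renaming (_≟_ to _≟ᵇ_)
open import Data.Fin using (Fin; zero; suc; inject₁; fromℕ)
open import Data.Fin.Patterns using (0F; 1F; 2F; 3F; 4F)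
open import Data.Fin.Subset using (Subset)
open import Data.Fin.Properties using (_≟_; any?; all?; ¬∀⟶∃¬; injective⇒≤; suc-injective)
open import Data.Vec using (tabulate)
open import Data.Vec.Properties using (lookup∘tabulate; lookup⇒[]=; []=⇒lookup)
open import Data.Vec.Functional using (_∷_; [])
open import Data.Product using (Σ; _×_; _,_; ∃; ∃₂; proj₁; proj₂; uncurry)
open import Data.Sum using (_⊎_; inj₁; inj₂)
open import Function using (_∘_; id)
open import Function.Definitions using (Injective)
open import Relation.Binary.PropositionalEquality using (_≡_; _≢_; refl; sym; trans; cong; subst)
open import Relation.Nullary using (¬_; Dec; yes; no; contradiction)
open import Relation.Nullary.Decidable
  using (True; toWitness; does; dec-true; decidable-stable; map′; ¬?; _→-dec_)
open import Relation.Unary using (Pred; Decidable)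

sumFin≥1⇒∃ : ∀ {k} (f : Fin k → ℕ) → 1 ≤ sumFin f → ∃ λ i → 1 ≤ f i
sumFin≥1⇒∃ {zero}  f ()
sumFin≥1⇒∃ {suc k} f 1≤Σ with f zero in eq
... | zero  = let i , 1≤fi = sumFin≥1⇒∃ (f ∘ suc) 1≤Σ in suc i , 1≤fi
... | suc _ = zero , subst (1 ≤_) (sym eq) (s≤s z≤n)

sumFin≥2⇒∃ : ∀ {k} (f : Fin k → ℕ) → 2 ≤ sumFin f →
             (∃ λ i → 2 ≤ f i) ⊎ (∃₂ λ i j → i ≢ j × 1 ≤ f i × 1 ≤ f j)
sumFin≥2⇒∃ {zero}  f ()
sumFin≥2⇒∃ {suc k} f 2≤Σ with f zero in eq
... | zero with sumFin≥2⇒∃ (f ∘ suc) 2≤Σ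
...   | inj₁ (i , 2≤fi)            = inj₁ (suc i , 2≤fi)
...   | inj₂ (i , j , i≢j , fi , fj) = inj₂ (suc i , suc j , i≢j ∘ suc-injective , fi , fj)
sumFin≥2⇒∃ {suc k} f (s≤s 1≤Σ) | suc zero =
  let j , 1≤fj = sumFin≥1⇒∃ (f ∘ suc) 1≤Σ in
  inj₂ (zero , suc j , (λ ()) , subst (1 ≤_) (sym eq) (s≤s z≤n) , 1≤fj)
sumFin≥2⇒∃ {suc k} f 2≤Σ | suc (suc _) = inj₁ (zero , subst (2 ≤_) (sym eq) (s≤s (s≤s z≤n)))

indicator : Bool → ℕ
indicator b = if b then 1 else 0

indicator≥1⇒true : ∀ {b} → 1 ≤ indicator b → b ≡ true
indicator≥1⇒true {true} _ = refl

indicator≱2 : ∀ {b} → ¬ 2 ≤ indicator b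
indicator≱2 {true} (s≤s ())

distinct∈pair⇒both : ∀ {A : Set} (P : A → Set) {a b u₁ u₂ : A} → u₁ ≢ u₂ →
                     u₁ ≡ a ⊎ u₁ ≡ b → u₂ ≡ a ⊎ u₂ ≡ b → P u₁ → P u₂ → a ≢ b × P a × P b
distinct∈pair⇒both P u₁≢u₂ (inj₁ refl) (inj₁ refl) _  _  = contradiction refl u₁≢u₂
distinct∈pair⇒both P u₁≢u₂ (inj₂ refl) (inj₂ refl) _  _  = contradiction refl u₁≢u₂
distinct∈pair⇒both P u₁≢u₂ (inj₁ refl) (inj₂ refl) Pa Pb = u₁≢u₂ , Pa , Pb
distinct∈pair⇒both P u₁≢u₂ (inj₂ refl) (inj₁ refl) Pb Pa = u₁≢u₂ ∘ sym , Pa , Pb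

does≡true⇒ : ∀ {A : Set} (a? : Dec A) → does a? ≡ true → A
does≡true⇒ (yes a) _ = a

does≡false⇒ : ∀ {A : Set} (a? : Dec A) → does a? ≡ false → ¬ A
does≡false⇒ (no ¬a) _ = ¬a

∧³-true : ∀ a b c → a ∧ b ∧ c ≡ true → a ≡ true × b ≡ true × c ≡ true
∧³-true true true true _ = refl , refl , refl

count : ∀ {k m} → (Fin k → Fin m → Bool) → ℕ
count b = sumFin λ i → sumFin λ j → indicator (b i j)

count≥2⇒∃₂ : ∀ {k m} (b : Fin k → Fin m → Bool) → 2 ≤ count b →
             ∃₂ λ e₁ e₂ → e₁ ≢ e₂ × uncurry b e₁ ≡ true × uncurry b e₂ ≡ true
count≥2⇒∃₂ b 2≤c with sumFin≥2⇒∃ _ 2≤c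
... | inj₂ (i₁ , i₂ , i₁≢i₂ , row₁ , row₂) =
  let j₁ , b₁ = sumFin≥1⇒∃ _ row₁ ; j₂ , b₂ = sumFin≥1⇒∃ _ row₂ in
  (i₁ , j₁) , (i₂ , j₂) , i₁≢i₂ ∘ cong proj₁ , indicator≥1⇒true b₁ , indicator≥1⇒true b₂
... | inj₁ (i , 2≤row) with sumFin≥2⇒∃ _ 2≤row
...   | inj₁ (_ , 2≤bij) = contradiction 2≤bij indicator≱2
...   | inj₂ (j₁ , j₂ , j₁≢j₂ , b₁ , b₂) =
  (i , j₁) , (i , j₂) , j₁≢j₂ ∘ cong proj₂ , indicator≥1⇒true b₁ , indicator≥1⇒true b₂

module _ {n : ℕ} (D : Digraph n) where

  infix 4 _⟶_ _⟶?_

  _⟶_ : Fin n → Fin n → Set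
  u ⟶ v = arc D u v ≡ true

  _⟶?_ : ∀ u v → Dec (u ⟶ v)
  u ⟶? v = arc D u v ≟ᵇ true

  Fresh : ∀ {m} → (Fin m → Fin n) → Fin n → Set
  Fresh q w = ∀ i → w ≢ q i

  Among : Fin n → Fin n → Pred (Fin n) 0ℓ
  Among a b u = u ≡ a ⊎ u ≡ b

  freshOrAmong : ∀ {m} {q : Fin m → Fin n} (R : Pred (Fin n) 0ℓ) {a b} →
                 (∀ i → R (q i) → Among a b (q i)) → ∀ {u} → R u → Fresh q u ⊎ Among a b u
  freshOrAmong {q = q} R among {u} Ru with any? (λ i → u ≟ q i)
  ... | yes (i , refl) = inj₂ (among i Ru)
  ... | no ¬on         = inj₁ λ i u≡qi → ¬on (i , u≡qi)

  ∃-fresh : ∀ {m} → m < n → (q : Fin m → Fin n) → ∃ (Fresh q)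
  ∃-fresh {m} m<n q with ¬∀⟶∃¬ n _ (λ w → any? (λ i → w ≟ q i)) covered
    where
    covered : ¬ (∀ w → ∃ λ i → w ≡ q i)
    covered preimage = <⇒≱ m<n (injective⇒≤ λ {w} {w′} e →
      trans (proj₂ (preimage w)) (trans (cong q e) (sym (proj₂ (preimage w′)))))
  ... | w , ¬on = w , λ i w≡qi → ¬on (i , w≡qi)

  IsPath : ∀ {k} → (Fin (suc k) → Fin n) → Set
  IsPath {k} p = Injective _≡_ _≡_ p × (∀ (i : Fin k) → p (inject₁ i) ⟶ p (suc i))

  singleVertexPath : Fin n → HasDirectedPath D 1
  singleVertexPath v = (λ _ → v) , (λ { {0F} {0F} _ → refl }) , λ ()

  ∷-injective : ∀ {m} {w} {q : Fin m → Fin n} → Fresh q w → Injective _≡_ _≡_ q →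
                Injective _≡_ _≡_ (w ∷ q)
  ∷-injective fresh inj {zero}  {zero}  _ = refl
  ∷-injective fresh inj {zero}  {suc j} e = contradiction e (fresh j)
  ∷-injective fresh inj {suc i} {zero}  e = contradiction (sym e) (fresh i)
  ∷-injective fresh inj {suc i} {suc j} e = cong suc (inj e)

  prepend : ∀ {k} {w} {q : Fin (suc k) → Fin n} → IsPath q → Fresh q w → w ⟶ q 0F →
            IsPath (w ∷ q)
  prepend (inj , arcs) fresh w⟶q₀ = ∷-injective fresh inj , λ where
    zero    → w⟶q₀
    (suc i) → arcs i

  _∷ʳ_ : ∀ {k} → (Fin (suc k) → Fin n) → Fin n → Fin (suc (suc k)) → Fin n
  (q ∷ʳ w) zero = q zero
  _∷ʳ_ {zero}  q w (suc zero) = w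
  _∷ʳ_ {suc k} q w (suc i)    = ((q ∘ suc) ∷ʳ w) i

  ∷ʳ-suc-range : ∀ {k} (q : Fin (suc k) → Fin n) w j →
                 (∃ λ i → (q ∷ʳ w) (suc j) ≡ q (suc i)) ⊎ (q ∷ʳ w) (suc j) ≡ w
  ∷ʳ-suc-range {zero}  q w zero    = inj₂ refl
  ∷ʳ-suc-range {suc k} q w zero    = inj₁ (zero , refl)
  ∷ʳ-suc-range {suc k} q w (suc j) with ∷ʳ-suc-range (q ∘ suc) w j
  ... | inj₁ (i , e) = inj₁ (suc i , e)
  ... | inj₂ e       = inj₂ e

  ∷ʳ-suc≢head : ∀ {k} {w} {q : Fin (suc k) → Fin n} → Fresh q w → Injective _≡_ _≡_ q →
                ∀ j → (q ∷ʳ w) (suc j) ≢ q 0F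
  ∷ʳ-suc≢head {w = w} {q} fresh inj j e with ∷ʳ-suc-range q w j
  ... | inj₁ (i , e′) = contradiction (inj (trans (sym e′) e)) λ ()
  ... | inj₂ e′       = fresh 0F (trans (sym e′) e)

  ∷ʳ-injective : ∀ {k} {w} {q : Fin (suc k) → Fin n} → Fresh q w → Injective _≡_ _≡_ q →
                 Injective _≡_ _≡_ (q ∷ʳ w)
  ∷ʳ-injective fresh inj {zero}  {zero}  _ = refl
  ∷ʳ-injective fresh inj {zero}  {suc j} e = contradiction (sym e) (∷ʳ-suc≢head fresh inj j)
  ∷ʳ-injective fresh inj {suc i} {zero}  e = contradiction e (∷ʳ-suc≢head fresh inj i)
  ∷ʳ-injective {zero}  fresh inj {suc zero} {suc zero} _ = refl
  ∷ʳ-injective {suc k} fresh inj {suc i}    {suc j}    e =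
    cong suc (∷ʳ-injective (fresh ∘ suc) (suc-injective ∘ inj) e)

  append : ∀ {k} {w} {q : Fin (suc k) → Fin n} → IsPath q → Fresh q w → q (fromℕ k) ⟶ w →
           IsPath (q ∷ʳ w)
  append (inj , arcs) fresh q⟶w = ∷ʳ-injective fresh inj , appendArcs arcs q⟶w
    where
    appendArcs : ∀ {k} {w} {q : Fin (suc k) → Fin n} → (∀ i → q (inject₁ i) ⟶ q (suc i)) →
                 q (fromℕ k) ⟶ w → ∀ i → (q ∷ʳ w) (inject₁ i) ⟶ (q ∷ʳ w) (suc i)
    appendArcs {zero}  arcs q⟶w zero    = q⟶w
    appendArcs {suc k} arcs q⟶w zero    = arcs zero
    appendArcs {suc k} arcs q⟶w (suc i) = appendArcs (arcs ∘ suc) q⟶w i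

  injective? : ∀ {m k} (σ : Fin m → Fin k) → Dec (Injective _≡_ _≡_ σ)
  injective? σ = map′ (λ inj {i} {j} → inj i j) (λ inj i j → inj)
                      (all? λ i → all? λ j → (σ i ≟ σ j) →-dec (i ≟ j))

  ReorderedPathFrom : ∀ {k} → (Fin (suc k) → Fin n) → Fin (suc k) → Set
  ReorderedPathFrom {k} q i = Σ (Fin (suc k) → Fin (suc k)) λ σ → σ 0F ≡ i × IsPath (q ∘ σ)

  reorder : ∀ {k} {q : Fin (suc k) → Fin n} → Injective _≡_ _≡_ q →
            (σ : Fin (suc k) → Fin (suc k)) {_ : True (injective? σ)} →
            (∀ i → q (σ (inject₁ i)) ⟶ q (σ (suc i))) → IsPath (q ∘ σ)
  reorder inj σ {σ-inj} arcs = toWitness σ-inj ∘ inj , arcs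

  irreflexive : IsOriented D → ∀ {v} → ¬ v ⟶ v
  irreflexive (loopFree , _) {v} v⟶v = contradiction (trans (sym v⟶v) (loopFree v)) λ ()

  asymmetric : IsOriented D → ∀ {u v} → u ⟶ v → ¬ v ⟶ u
  asymmetric (_ , digonFree) {u} {v} u⟶v v⟶u =
    contradiction (trans (sym v⟶u) (digonFree u v u⟶v)) λ ()

  module _ (strong : IsTwoArcStrong D) where

    Leaving : Pred (Fin n) 0ℓ → Fin n × Fin n → Set
    Leaving P (u , v) = P u × ¬ P v × u ⟶ v

    module _ {P : Pred (Fin n) 0ℓ} (P? : Decidable P) {w v : Fin n} (Pw : P w) (¬Pv : ¬ P v) where

      private
        X : Subset n
        X = tabulate (does ∘ P?)

        memb-X : ∀ u → memb X u ≡ does (P? u)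
        memb-X = lookup∘tabulate (does ∘ P?)

        X-nonemptyProper : NonemptyProper X
        X-nonemptyProper =
          (w , lookup⇒[]= w X (trans (memb-X w) (dec-true (P? w) Pw))) ,
          (v , λ v∈X → ¬Pv (does≡true⇒ (P? v) (trans (sym (memb-X v)) ([]=⇒lookup v∈X))))

        crossing : ∀ {u u′} → (memb X u ∧ not (memb X u′) ∧ arc D u u′) ≡ true → Leaving P (u , u′)
        crossing {u} {u′} t =
          let u∈X , u′∉X , u⟶u′ = ∧³-true (memb X u) (not (memb X u′)) (arc D u u′) t in
          does≡true⇒ (P? u) (trans (sym (memb-X u)) u∈X) ,
          does≡false⇒ (P? u′) (trans (sym (memb-X u′)) (not-injective u′∉X)) ,
          u⟶u′

      -- Opaque, since unfolding the counting proof makes every later with-abstraction very slow.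
      opaque
        twoArcsLeaving : ∃₂ λ e₁ e₂ → e₁ ≢ e₂ × Leaving P e₁ × Leaving P e₂
        twoArcsLeaving =
          let e₁ , e₂ , e₁≢e₂ , c₁ , c₂ = count≥2⇒∃₂ _ (strong X X-nonemptyProper) in
          e₁ , e₂ , e₁≢e₂ , crossing c₁ , crossing c₂

    Entering : Pred (Fin n) 0ℓ → Fin n × Fin n → Set
    Entering P (u , v) = ¬ P u × P v × u ⟶ v

    module _ {P : Pred (Fin n) 0ℓ} (P? : Decidable P) {w v : Fin n} (Pw : P w) (¬Pv : ¬ P v) where

      private
        leaving¬⇒entering : ∀ {e} → Leaving (¬_ ∘ P) e → Entering P e
        leaving¬⇒entering {_ , v′} (¬Pu , ¬¬Pv′ , u⟶v′) =
          ¬Pu , decidable-stable (P? v′) ¬¬Pv′ , u⟶v′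

      twoArcsEntering : ∃₂ λ e₁ e₂ → e₁ ≢ e₂ × Entering P e₁ × Entering P e₂
      twoArcsEntering =
        let e₁ , e₂ , e₁≢e₂ , leaving₁ , leaving₂ = twoArcsLeaving (¬? ∘ P?) ¬Pv (λ ¬Pw → ¬Pw Pw)
        in e₁ , e₂ , e₁≢e₂ , leaving¬⇒entering leaving₁ , leaving¬⇒entering leaving₂

    outNeighbours : 1 < n → ∀ v → ∃₂ λ w₁ w₂ → w₁ ≢ w₂ × v ⟶ w₁ × v ⟶ w₂
    outNeighbours 1<n v with ∃-fresh 1<n (λ _ → v)
    ... | w , w≢v with twoArcsLeaving (_≟ v) refl (w≢v 0F)
    ... | (_ , w₁) , (_ , w₂) , e₁≢e₂ , (refl , _ , v⟶w₁) , (refl , _ , v⟶w₂) =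
      w₁ , w₂ , e₁≢e₂ ∘ cong (v ,_) , v⟶w₁ , v⟶w₂

    inNeighbours : 1 < n → ∀ v → ∃₂ λ u₁ u₂ → u₁ ≢ u₂ × u₁ ⟶ v × u₂ ⟶ v
    inNeighbours 1<n v with ∃-fresh 1<n (λ _ → v)
    ... | w , w≢v with twoArcsEntering (_≟ v) refl (w≢v 0F)
    ... | (u₁ , _) , (u₂ , _) , e₁≢e₂ , (_ , refl , u₁⟶v) , (_ , refl , u₂⟶v) =
      u₁ , u₂ , e₁≢e₂ ∘ cong (_, v) , u₁⟶v , u₂⟶v

    arcInto : ∀ {k} → suc k < n → (q : Fin (suc k) → Fin n) → ∃₂ λ x i → Fresh q x × x ⟶ q i
    arcInto k<n q with ∃-fresh k<n q
    ... | w , w-fresh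
        with twoArcsEntering (λ u → any? (λ i → u ≟ q i)) (0F , refl) (λ (i , w≡qi) → w-fresh i w≡qi)
    ... | (x , _) , _ , _ , (¬on , (i , refl) , x⟶qi) , _ =
      x , i , (λ j x≡qj → ¬on (j , x≡qj)) , x⟶qi

    prependOrInNeighbours : 1 < n → ∀ {k a b} {q : Fin (suc k) → Fin n} → IsPath q →
                            (∀ i → q i ⟶ q 0F → Among a b (q i)) →
                            HasDirectedPath D (suc (suc k)) ⊎ (a ≢ b × a ⟶ q 0F × b ⟶ q 0F)
    prependOrInNeighbours 1<n {q = q} path among with inNeighbours 1<n (q 0F)
    ... | u₁ , u₂ , u₁≢u₂ , u₁⟶q₀ , u₂⟶q₀
        with freshOrAmong (_⟶ q 0F) among u₁⟶q₀ | freshOrAmong (_⟶ q 0F) among u₂⟶q₀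
    ... | inj₁ fresh | _          = inj₁ (_ , prepend path fresh u₁⟶q₀)
    ... | inj₂ _     | inj₁ fresh = inj₁ (_ , prepend path fresh u₂⟶q₀)
    ... | inj₂ u₁∈   | inj₂ u₂∈   =
      inj₂ (distinct∈pair⇒both (_⟶ q 0F) u₁≢u₂ u₁∈ u₂∈ u₁⟶q₀ u₂⟶q₀)

    appendOrOutNeighbours : 1 < n → ∀ {k a b} {q : Fin (suc k) → Fin n} → IsPath q →
                            (∀ i → q (fromℕ k) ⟶ q i → Among a b (q i)) →
                            HasDirectedPath D (suc (suc k)) ⊎
                            (a ≢ b × q (fromℕ k) ⟶ a × q (fromℕ k) ⟶ b)
    appendOrOutNeighbours 1<n {k} {q = q} path among with outNeighbours 1<n (q (fromℕ k))
    ... | w₁ , w₂ , w₁≢w₂ , qₖ⟶w₁ , qₖ⟶w₂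
        with freshOrAmong (q (fromℕ k) ⟶_) among qₖ⟶w₁ | freshOrAmong (q (fromℕ k) ⟶_) among qₖ⟶w₂
    ... | inj₁ fresh | _          = inj₁ (_ , append path fresh qₖ⟶w₁)
    ... | inj₂ _     | inj₁ fresh = inj₁ (_ , append path fresh qₖ⟶w₂)
    ... | inj₂ w₁∈   | inj₂ w₂∈   =
      inj₂ (distinct∈pair⇒both (q (fromℕ k) ⟶_) w₁≢w₂ w₁∈ w₂∈ qₖ⟶w₁ qₖ⟶w₂)

    extendFromAnyStart : ∀ {k} → suc k < n → (q : Fin (suc k) → Fin n) →
                         (∀ i → ReorderedPathFrom q i) → HasDirectedPath D (suc (suc k))
    extendFromAnyStart k<n q from with arcInto k<n q
    ... | x , i , fresh , x⟶qi with from i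
    ... | σ , refl , path = _ , prepend path (fresh ∘ σ) x⟶qi

    prependIfOneInNeighbourOnPath : 1 < n → ∀ {k c} {q : Fin (suc k) → Fin n} → IsPath q →
                                    (∀ i → q i ⟶ q 0F → q i ≡ c) → HasDirectedPath D (suc (suc k))
    prependIfOneInNeighbourOnPath 1<n path onlyC
      with prependOrInNeighbours 1<n path (λ i → inj₁ ∘ onlyC i)
    ... | inj₁ longer     = longer
    ... | inj₂ (c≢c , _) = contradiction refl c≢c

    module _ (oriented : IsOriented D) where

      extendShortPath : 1 < n → ∀ {k} → k < 3 →
                        HasDirectedPath D (suc k) → HasDirectedPath D (suc (suc k))
      extendShortPath 1<n k<3 (q , path) = prependIfOneInNeighbourOnPath 1<n path (onlyLast k<3 path)
        where
        onlyLast : ∀ {k} {q : Fin (suc k) → Fin n} → k < 3 → IsPath q →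
                   ∀ i → q i ⟶ q 0F → q i ≡ q (fromℕ k)
        onlyLast {0}     _ _          0F _      = refl
        onlyLast {suc _} _ _          0F q₀⟶q₀ = contradiction q₀⟶q₀ (irreflexive oriented)
        onlyLast {1}     _ _          1F _      = refl
        onlyLast {2}     _ (_ , arcs) 1F q₁⟶q₀ = contradiction q₁⟶q₀ (asymmetric oriented (arcs 0F))
        onlyLast {2}     _ _          2F _      = refl
        onlyLast {suc (suc (suc _))} (s<s (s<s (s<s ()))) _ _ _

      extendClosedPath₄ : 4 < n → ∀ {q : Fin 4 → Fin n} → IsPath q → q 3F ⟶ q 0F → HasDirectedPath D 5
      extendClosedPath₄ 4<n {q} path@(inj , arcs) q₃⟶q₀ = extendFromAnyStart 4<n q λ where
        0F → id , refl , path
        1F → _ , refl , reorder inj (1F ∷ 2F ∷ 3F ∷ 0F ∷ []) λ where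
               0F → arcs 1F ; 1F → arcs 2F ; 2F → q₃⟶q₀
        2F → _ , refl , reorder inj (2F ∷ 3F ∷ 0F ∷ 1F ∷ []) λ where
               0F → arcs 2F ; 1F → q₃⟶q₀ ; 2F → arcs 0F
        3F → _ , refl , reorder inj (3F ∷ 0F ∷ 1F ∷ 2F ∷ []) λ where
               0F → q₃⟶q₀ ; 1F → arcs 0F ; 2F → arcs 1F

      extendPath₄ : 4 < n → HasDirectedPath D 4 → HasDirectedPath D 5
      extendPath₄ 4<n (q , path@(_ , arcs)) with q 3F ⟶? q 0F
      ... | yes q₃⟶q₀ = extendClosedPath₄ 4<n path q₃⟶q₀
      ... | no q₃↛q₀  = prependIfOneInNeighbourOnPath (<-trans (s≤s (s≤s z≤n)) 4<n) path onlyQ₂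
        where
        onlyQ₂ : ∀ i → q i ⟶ q 0F → q i ≡ q 2F
        onlyQ₂ 0F q₀⟶q₀ = contradiction q₀⟶q₀ (irreflexive oriented)
        onlyQ₂ 1F q₁⟶q₀ = contradiction q₁⟶q₀ (asymmetric oriented (arcs 0F))
        onlyQ₂ 2F _      = refl
        onlyQ₂ 3F q₃⟶q₀ = contradiction q₃⟶q₀ q₃↛q₀

      extendClosedPath₅ : 5 < n → ∀ {q : Fin 5 → Fin n} → IsPath q → q 4F ⟶ q 0F → HasDirectedPath D 6
      extendClosedPath₅ 5<n {q} path@(inj , arcs) q₄⟶q₀ = extendFromAnyStart 5<n q λ where
        0F → id , refl , path
        1F → _ , refl , reorder inj (1F ∷ 2F ∷ 3F ∷ 4F ∷ 0F ∷ []) λ where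
               0F → arcs 1F ; 1F → arcs 2F ; 2F → arcs 3F ; 3F → q₄⟶q₀
        2F → _ , refl , reorder inj (2F ∷ 3F ∷ 4F ∷ 0F ∷ 1F ∷ []) λ where
               0F → arcs 2F ; 1F → arcs 3F ; 2F → q₄⟶q₀ ; 3F → arcs 0F
        3F → _ , refl , reorder inj (3F ∷ 4F ∷ 0F ∷ 1F ∷ 2F ∷ []) λ where
               0F → arcs 3F ; 1F → q₄⟶q₀ ; 2F → arcs 0F ; 3F → arcs 1F
        4F → _ , refl , reorder inj (4F ∷ 0F ∷ 1F ∷ 2F ∷ 3F ∷ []) λ where
               0F → q₄⟶q₀ ; 1F → arcs 0F ; 2F → arcs 1F ; 3F → arcs 2F

      extendOpenPath₅ : 5 < n → ∀ {q : Fin 5 → Fin n} → IsPath q → ¬ q 4F ⟶ q 0F → HasDirectedPath D 6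
      extendOpenPath₅ 5<n {q} path@(inj , arcs) q₄↛q₀ = chordsOrLonger
        where
        1<n : 1 < n
        1<n = <-trans (s≤s (s≤s z≤n)) 5<n

        outOfQ₄ : ∀ i → q 4F ⟶ q i → Among (q 1F) (q 2F) (q i)
        outOfQ₄ 0F q₄⟶q₀ = contradiction q₄⟶q₀ q₄↛q₀
        outOfQ₄ 1F _      = inj₁ refl
        outOfQ₄ 2F _      = inj₂ refl
        outOfQ₄ 3F q₄⟶q₃ = contradiction q₄⟶q₃ (asymmetric oriented (arcs 3F))
        outOfQ₄ 4F q₄⟶q₄ = contradiction q₄⟶q₄ (irreflexive oriented)

        intoQ₀ : ∀ i → q i ⟶ q 0F → Among (q 2F) (q 3F) (q i)
        intoQ₀ 0F q₀⟶q₀ = contradiction q₀⟶q₀ (irreflexive oriented)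
        intoQ₀ 1F q₁⟶q₀ = contradiction q₁⟶q₀ (asymmetric oriented (arcs 0F))
        intoQ₀ 2F _      = inj₁ refl
        intoQ₀ 3F _      = inj₂ refl
        intoQ₀ 4F q₄⟶q₀ = contradiction q₄⟶q₀ q₄↛q₀

        detourOrder : Fin 5 → Fin 5
        detourOrder = 3F ∷ 4F ∷ 2F ∷ 0F ∷ 1F ∷ []

        detour : q 4F ⟶ q 2F → q 2F ⟶ q 0F → IsPath (q ∘ detourOrder)
        detour q₄⟶q₂ q₂⟶q₀ = reorder inj detourOrder λ where
          0F → arcs 3F ; 1F → q₄⟶q₂ ; 2F → q₂⟶q₀ ; 3F → arcs 0F

        outOfQ₁ : q 4F ⟶ q 1F →
                  ∀ i → q 1F ⟶ q (detourOrder i) → Among (q 2F) (q 3F) (q (detourOrder i))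
        outOfQ₁ _      0F _      = inj₂ refl
        outOfQ₁ q₄⟶q₁ 1F q₁⟶q₄ = contradiction q₁⟶q₄ (asymmetric oriented q₄⟶q₁)
        outOfQ₁ _      2F _      = inj₁ refl
        outOfQ₁ _      3F q₁⟶q₀ = contradiction q₁⟶q₀ (asymmetric oriented (arcs 0F))
        outOfQ₁ _      4F q₁⟶q₁ = contradiction q₁⟶q₁ (irreflexive oriented)

        everyStart : q 4F ⟶ q 1F → q 4F ⟶ q 2F → q 2F ⟶ q 0F → q 3F ⟶ q 0F → q 1F ⟶ q 3F →
                     ∀ i → ReorderedPathFrom q i
        everyStart q₄⟶q₁ q₄⟶q₂ q₂⟶q₀ q₃⟶q₀ q₁⟶q₃ = λ where
          0F → id , refl , path
          1F → _ , refl , reorder inj (1F ∷ 3F ∷ 4F ∷ 2F ∷ 0F ∷ []) λ where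
                 0F → q₁⟶q₃ ; 1F → arcs 3F ; 2F → q₄⟶q₂ ; 3F → q₂⟶q₀
          2F → _ , refl , reorder inj (2F ∷ 0F ∷ 1F ∷ 3F ∷ 4F ∷ []) λ where
                 0F → q₂⟶q₀ ; 1F → arcs 0F ; 2F → q₁⟶q₃ ; 3F → arcs 3F
          3F → _ , refl , reorder inj (3F ∷ 4F ∷ 1F ∷ 2F ∷ 0F ∷ []) λ where
                 0F → arcs 3F ; 1F → q₄⟶q₁ ; 2F → arcs 1F ; 3F → q₂⟶q₀
          4F → _ , refl , reorder inj (4F ∷ 1F ∷ 2F ∷ 3F ∷ 0F ∷ []) λ where
                 0F → q₄⟶q₁ ; 1F → arcs 1F ; 2F → arcs 2F ; 3F → q₃⟶q₀

        chordsOrLonger : HasDirectedPath D 6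
        chordsOrLonger with appendOrOutNeighbours 1<n path outOfQ₄
        ... | inj₁ longer = longer
        ... | inj₂ (_ , q₄⟶q₁ , q₄⟶q₂) with prependOrInNeighbours 1<n path intoQ₀
        ... | inj₁ longer = longer
        ... | inj₂ (_ , q₂⟶q₀ , q₃⟶q₀)
            with appendOrOutNeighbours 1<n (detour q₄⟶q₂ q₂⟶q₀) (outOfQ₁ q₄⟶q₁)
        ... | inj₁ longer = longer
        ... | inj₂ (_ , _ , q₁⟶q₃) =
          extendFromAnyStart 5<n q (everyStart q₄⟶q₁ q₄⟶q₂ q₂⟶q₀ q₃⟶q₀ q₁⟶q₃)

      extendPath₅ : 5 < n → HasDirectedPath D 5 → HasDirectedPath D 6
      extendPath₅ 5<n (q , path) with q 4F ⟶? q 0F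
      ... | yes q₄⟶q₀ = extendClosedPath₅ 5<n path q₄⟶q₀
      ... | no q₄↛q₀  = extendOpenPath₅ 5<n path q₄↛q₀

proposition7 : (n : ℕ) → 7 ≤ n → (D : Digraph n) →
    IsOriented D → IsTwoArcStrong D → HasDirectedPath D 6
proposition7 n@(suc _) 7≤n D oriented strong =
  extendPath₅ D strong oriented 5<n
    (extendPath₄ D strong oriented 4<n
      (extend (s<s (s<s z<s)) (extend (s<s z<s) (extend z<s (singleVertexPath D zero)))))
  where
  5<n : 5 < n
  5<n = <-trans (n<1+n 5) 7≤n

  4<n : 4 < n
  4<n = <-trans (n<1+n 4) 5<n

  extend : ∀ {k} → k < 3 → HasDirectedPath D (suc k) → HasDirectedPath D (suc (suc k))
  extend = extendShortPath D strong oriented (<-trans (s≤s (s≤s z≤n)) 4<n)
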